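{- Every finite simple graph $H$ is an induced subgraph of some group vertex magic graph, i.e. of a graph $H'$ that is $A$-vertex magic for every nontrivial abelian group $A$.
   Context: For an additive abelian group $A$ with identity $0$ and a graph $G$, an $A$-vertex magic labeling of $G$ is a map $l:V(G)\to A\setminus\{0\}$ for which there is $\mu\in A$ such that $\sum_{u\in N_G(v)} l(u)=\mu$ for every $v\in V(G)$. $G$ is $A$-vertex magic if such a labeling exists, and $G$ is group vertex magic if it is $A$-vertex magic for every nontrivial abelian group $A$. -}

module Defs where

open import Level using (Level; _⊔_)
open import Data.Nat using (ℕ; zero; suc)
open import Data.Fin using (Fin; zero; suc)
open import Data.Bool using (Bool; true; false; if_then_else_)
open import Data.Product using (Σ; ∃; _×_; _,_)
open import Relation.Binary.PropositionalEquality using (_≡_)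
open import Relation.Nullary using (¬_)
open import Function.Definitions using (Injective)
open import Algebra.Bundles using (AbelianGroup)

record Graph (n : ℕ) : Set where
  field
    adj     : Fin n → Fin n → Bool
    symm    : ∀ u v → adj u v ≡ adj v u
    irrefl  : ∀ v → adj v v ≡ false
open Graph public

record InducedSubgraphOf {n m : ℕ} (H : Graph n) (H' : Graph m) : Set where
  field
    emb       : Fin n → Fin m
    emb-inj   : Injective _≡_ _≡_ emb
    emb-adj   : ∀ u v → adj H' (emb u) (emb v) ≡ adj H u v
open InducedSubgraphOf public

module _ {c ℓ : Level} (A : AbelianGroup c ℓ) where
  open AbelianGroup A renaming (Carrier to ∣A∣)

  ΣFin : (m : ℕ) → (Fin m → ∣A∣) → ∣A∣
  ΣFin zero    f = ε
  ΣFin (suc m) f = f zero ∙ ΣFin m (λ i → f (suc i))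

  neighbourSum : {m : ℕ} (G : Graph m) (l : Fin m → ∣A∣) (v : Fin m) → ∣A∣
  neighbourSum {m} G l v = ΣFin m (λ u → if adj G v u then l u else ε)

  IsVertexMagicLabeling : {m : ℕ} (G : Graph m) (l : Fin m → ∣A∣) → Set (c ⊔ ℓ)
  IsVertexMagicLabeling G l =
    (∀ v → ¬ (l v ≈ ε)) × (Σ ∣A∣ λ μ → ∀ v → neighbourSum G l v ≈ μ)

  IsAVertexMagic : {m : ℕ} (G : Graph m) → Set (c ⊔ ℓ)
  IsAVertexMagic {m} G = Σ (Fin m → ∣A∣) λ l → IsVertexMagicLabeling G l

  Nontrivial : Set (c ⊔ ℓ)
  Nontrivial = Σ ∣A∣ λ x → ¬ (x ≈ ε)

GroupVertexMagic : {m : ℕ} (G : Graph m) → Set₁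
GroupVertexMagic G = (A : AbelianGroup Level.zero Level.zero) → Nontrivial A → IsAVertexMagic A G

-- Replace every vertex of H by two non-adjacent twins with the same neighbourhood. The original
-- copy of H is induced, and labelling the two twins of each vertex by x and -x (for any x ≠ 0)
-- makes every neighbourhood sum 0, since neighbourhoods consist of whole pairs of twins.
{-# OPTIONS --safe #-}
module Submission where

open import Defs
open import Level using (Level)
open import Data.Nat using (ℕ; zero; suc; _+_)
open import Data.Product using (Σ; _×_; _,_)
open import Data.Sum using (inj₁; inj₂; [_,_]′)
open import Data.Bool using (true; false; if_then_else_)
open import Data.Fin using (Fin; zero; suc; _↑ˡ_; _↑ʳ_; splitAt)
open import Data.Fin.Properties using (↑ˡ-injective; splitAt-↑ˡ; splitAt-↑ʳ)
open import Data.Vec.Functional using (Vector; replicate; _++_)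
open import Data.Vec.Functional.Properties using (lookup-++ˡ; lookup-++ʳ)
open import Function using (id; _∘_)
open import Relation.Nullary using (¬_)
open import Relation.Binary.PropositionalEquality as ≡ using (_≡_)
open import Algebra.Bundles using (AbelianGroup)
import Algebra.Properties.Group as GroupProperties
import Algebra.Properties.CommutativeMonoid.Sum as Sum
import Relation.Binary.Reasoning.Setoid as SetoidReasoning

private
  variable
    c ℓ : Level
    m n : ℕ

collapse : Fin (n + n) → Fin n
collapse {n} i = [ id , id ]′ (splitAt n i)

collapse-↑ˡ : (i : Fin n) → collapse (i ↑ˡ n) ≡ i
collapse-↑ˡ {n} i = ≡.cong [ id , id ]′ (splitAt-↑ˡ n i n)

collapse-↑ʳ : (i : Fin n) → collapse (n ↑ʳ i) ≡ i
collapse-↑ʳ {n} i = ≡.cong [ id , id ]′ (splitAt-↑ʳ n n i)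

duplicate : Graph n → Graph (n + n)
duplicate H = record
  { adj    = λ u v → adj H (collapse u) (collapse v)
  ; symm   = λ u v → symm H (collapse u) (collapse v)
  ; irrefl = λ v → irrefl H (collapse v)
  }

inducedSubgraph-duplicate : (H : Graph n) → InducedSubgraphOf H (duplicate H)
inducedSubgraph-duplicate {n} H = record
  { emb     = _↑ˡ n
  ; emb-inj = ↑ˡ-injective n _ _
  ; emb-adj = λ u v → ≡.cong₂ (adj H) (collapse-↑ˡ u) (collapse-↑ˡ v)
  }

module _ (A : AbelianGroup c ℓ) where
  open AbelianGroup A renaming (Carrier to ∣A∣)
  open GroupProperties group using (ε⁻¹≈ε; ⁻¹-injective)
  open Sum commutativeMonoid using (sum; sum-cong-≋; sum-cong-≗; ∑-distrib-+; sum-replicate-zero)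
  open SetoidReasoning setoid

  ΣFin≡sum : ∀ m (f : Vector ∣A∣ m) → ΣFin A m f ≡ sum f
  ΣFin≡sum zero    f = ≡.refl
  ΣFin≡sum (suc m) f = ≡.cong (f zero ∙_) (ΣFin≡sum m (f ∘ suc))

  sum-↑ : ∀ m n (f : Vector ∣A∣ (m + n)) → sum f ≈ sum (f ∘ (_↑ˡ n)) ∙ sum (f ∘ (m ↑ʳ_))
  sum-↑ zero    n f = sym (identityˡ _)
  sum-↑ (suc m) n f = begin
    f zero ∙ sum (f ∘ suc)                                            ≈⟨ ∙-congˡ (sum-↑ m n (f ∘ suc)) ⟩
    f zero ∙ (sum (f ∘ suc ∘ (_↑ˡ n)) ∙ sum (f ∘ suc ∘ (m ↑ʳ_)))     ≈⟨ assoc _ _ _ ⟨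
    (f zero ∙ sum (f ∘ suc ∘ (_↑ˡ n))) ∙ sum (f ∘ suc ∘ (m ↑ʳ_))     ∎

  if-∙ : ∀ b x y → (if b then x else ε) ∙ (if b then y else ε) ≈ (if b then x ∙ y else ε)
  if-∙ true  x y = refl
  if-∙ false x y = identityˡ ε

  neighbourSum-duplicate : (H : Graph n) (l : Vector ∣A∣ (n + n)) (v : Fin (n + n)) →
    neighbourSum A (duplicate H) l v ≈
    neighbourSum A H (λ u → l (u ↑ˡ n) ∙ l (n ↑ʳ u)) (collapse v)
  neighbourSum-duplicate {n} H l v = begin
    neighbourSum A (duplicate H) l v
      ≡⟨ ΣFin≡sum (n + n) _ ⟩
    sum (λ u → if adj H w (collapse u) then l u else ε)
      ≈⟨ sum-↑ n n _ ⟩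
    sum (λ u → if adj H w (collapse (u ↑ˡ n)) then l (u ↑ˡ n) else ε) ∙
    sum (λ u → if adj H w (collapse (n ↑ʳ u)) then l (n ↑ʳ u) else ε)
      ≡⟨ ≡.cong₂ _∙_ (sum-cong-≗ (λ u → ≡.cong (λ i → if adj H w i then l (u ↑ˡ n) else ε) (collapse-↑ˡ u)))
                     (sum-cong-≗ (λ u → ≡.cong (λ i → if adj H w i then l (n ↑ʳ u) else ε) (collapse-↑ʳ u))) ⟩
    sum (λ u → if adj H w u then l (u ↑ˡ n) else ε) ∙ sum (λ u → if adj H w u then l (n ↑ʳ u) else ε)
      ≈⟨ ∑-distrib-+ {n} _ _ ⟨
    sum (λ u → (if adj H w u then l (u ↑ˡ n) else ε) ∙ (if adj H w u then l (n ↑ʳ u) else ε))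
      ≈⟨ sum-cong-≋ (λ u → if-∙ (adj H w u) _ _) ⟩
    sum (λ u → if adj H w u then l (u ↑ˡ n) ∙ l (n ↑ʳ u) else ε)
      ≡⟨ ΣFin≡sum n _ ⟨
    neighbourSum A H (λ u → l (u ↑ˡ n) ∙ l (n ↑ʳ u)) w ∎
    where w = collapse v

  neighbourSum-≈ε : (G : Graph m) (l : Vector ∣A∣ m) → (∀ u → l u ≈ ε) → ∀ v → neighbourSum A G l v ≈ ε
  neighbourSum-≈ε {m} G l l≈ε v = begin
    neighbourSum A G l v                            ≡⟨ ΣFin≡sum m _ ⟩
    sum (λ u → if adj G v u then l u else ε)        ≈⟨ sum-cong-≋ (λ u → if-≈ε (adj G v u) (l≈ε u)) ⟩
    sum (replicate m ε)                             ≈⟨ sum-replicate-zero m ⟩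
    ε                                               ∎
    where
    if-≈ε : ∀ b {x} → x ≈ ε → (if b then x else ε) ≈ ε
    if-≈ε true  x≈ε = x≈ε
    if-≈ε false _   = refl

  duplicate-isAVertexMagic : (H : Graph n) → Nontrivial A → IsAVertexMagic A (duplicate H)
  duplicate-isAVertexMagic {n} H (x , x≉ε) = l , l≉ε , ε , neighbourSum≈ε
    where
    l : Vector ∣A∣ (n + n)
    l = replicate n x ++ replicate n (x ⁻¹)

    x⁻¹≉ε : ¬ (x ⁻¹ ≈ ε)
    x⁻¹≉ε x⁻¹≈ε = x≉ε (⁻¹-injective (trans x⁻¹≈ε (sym ε⁻¹≈ε)))

    l≉ε : ∀ v → ¬ (l v ≈ ε)
    l≉ε v with splitAt n v
    ... | inj₁ _ = x≉ε
    ... | inj₂ _ = x⁻¹≉ε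

    twins-cancel : ∀ u → l (u ↑ˡ n) ∙ l (n ↑ʳ u) ≈ ε
    twins-cancel u rewrite lookup-++ˡ (replicate n x) (replicate n (x ⁻¹)) u
                         | lookup-++ʳ (replicate n x) (replicate n (x ⁻¹)) u = inverseʳ x

    neighbourSum≈ε : ∀ v → neighbourSum A (duplicate H) l v ≈ ε
    neighbourSum≈ε v = trans (neighbourSum-duplicate H l v) (neighbourSum-≈ε H _ twins-cancel (collapse v))

mainTheorem12 : (n : ℕ) (H : Graph n) →
    Σ ℕ λ m → Σ (Graph m) λ H' → InducedSubgraphOf H H' × GroupVertexMagic H'
mainTheorem12 n H =
  n + n , duplicate H , inducedSubgraph-duplicate H , λ A → duplicate-isAVertexMagic A H
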